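{- Let $q_1,q_2$ be distinct odd prime powers with $|\sqrt{q_1}-\sqrt{q_2}|\le 1$, and let $\Delta=(q_1-q_2)^2-2(q_1+q_2)+1$. Then $\Delta<0$, $\Delta\equiv 1\pmod 4$, and $|\Delta|$ is not a perfect square. -}

module Defs where

open import Data.Nat as ℕ using (ℕ; suc)
open import Data.Nat.Primality using (Prime)
open import Data.Integer as ℤ using (ℤ; +_; _+_; _-_; _*_; _≤_)
open import Data.Product using (Σ; ∃; _×_)
open import Data.Sum using (_⊎_)
open import Relation.Binary.PropositionalEquality using (_≡_)

IsPrimePower : ℕ → Set
IsPrimePower q = Σ ℕ λ p → Σ ℕ λ k → Prime p × q ≡ p ℕ.^ suc k

-- √a ≤ √b + 1  (a, b : ℕ), stated without reals.
-- Equivalent (over the reals) to  a - b - 1 ≤ 2√b, i.e.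
-- either a - b - 1 ≤ 0, or (a - b - 1)^2 ≤ 4b.
SqrtLeSqrtPlusOne : ℕ → ℕ → Set
SqrtLeSqrtPlusOne a b =
  let t = + a - + b - + 1 in (t ≤ + 0) ⊎ (t * t ≤ + 4 * + b)

SqrtDistLeOne : ℕ → ℕ → Set
SqrtDistLeOne a b = SqrtLeSqrtPlusOne a b × SqrtLeSqrtPlusOne b a

Δ : ℕ → ℕ → ℤ
Δ q₁ q₂ = (+ q₁ - + q₂) * (+ q₁ - + q₂) - + 2 * (+ q₁ + + q₂) + + 1

{-# OPTIONS --safe #-}
-- For q₂ < q₁ put t = q₁ - q₂ - 1. Then Δ = t² - 4q₂, t is odd because q₁ and q₂ are,
-- and √q₁ ≤ √q₂ + 1 says t ≤ 2√q₂. Since t² ≡ 1 and 4q₂ ≡ 0 (mod 4), this forces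
-- 4q₂ - t² = 3 + 4k for some k, so Δ = -(3 + 4k) is negative, ≡ 1 (mod 4), and its
-- absolute value is ≡ 3 (mod 4), hence not a square.
module Submission where

open import Defs
open import Data.Nat as ℕ using (ℕ; _%_)
open import Data.Integer using (ℤ; +_; _<_; ∣_∣)
open import Data.Integer.DivMod using (_%ℕ_)
open import Data.Product using (_×_; ∃)
open import Relation.Binary.PropositionalEquality using (_≡_; _≢_)
open import Relation.Nullary using (¬_)

open import Data.Empty using (⊥-elim)
open import Data.Integer as ℤ using (-_; -[1+_]; +≤+; -<+)
import Data.Integer.Properties as ℤₚ
import Data.Integer.Tactic.RingSolver as ℤ-Solver
open import Data.Nat.DivMod using (_/_; m≡m%n+[m/n]*n; [m+kn]%n≡m%n; %-distribˡ-*; m%n<n)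
import Data.Nat.Properties as ℕₚ
import Data.Nat.Tactic.RingSolver as ℕ-Solver
open import Data.Product using (_,_; proj₁; proj₂)
open import Data.Sum using (inj₁; inj₂)
open import Relation.Binary.Definitions using (tri<; tri≈; tri>)
open import Relation.Binary.PropositionalEquality
  using (refl; sym; trans; cong; cong₂; subst; subst₂; module ≡-Reasoning)

square%4≢3 : ∀ m → m ℕ.* m % 4 ≢ 3
square%4≢3 m m²%4≡3 =
  residue (m % 4) (m%n<n m 4) (trans (sym (%-distribˡ-* m m 4)) m²%4≡3)
  where
  residue : ∀ r → r ℕ.< 4 → r ℕ.* r % 4 ≢ 3
  residue 0 _ ()
  residue 1 _ ()
  residue 2 _ ()
  residue 3 _ ()
  residue (ℕ.suc (ℕ.suc (ℕ.suc (ℕ.suc _)))) (ℕ.s≤s (ℕ.s≤s (ℕ.s≤s (ℕ.s≤s ()))))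

3+4k≢square : ∀ k m → 3 ℕ.+ k ℕ.* 4 ≢ m ℕ.* m
3+4k≢square k m eq =
  square%4≢3 m (trans (cong (_% 4) (sym eq)) ([m+kn]%n≡m%n 3 k 4))

[1+n]%4≡3⇒-[1+n]%ℕ4≡1 : ∀ n → ℕ.suc n % 4 ≡ 3 → -[1+ n ] %ℕ 4 ≡ 1
[1+n]%4≡3⇒-[1+n]%ℕ4≡1 n eq with ℕ.suc n % 4
[1+n]%4≡3⇒-[1+n]%ℕ4≡1 n refl | .3 = refl

-[3+4k]-negative-1mod4-nonsquare : ∀ {d} k → d ≡ - + (3 ℕ.+ k ℕ.* 4) →
  (d < + 0) × (d %ℕ 4 ≡ 1) × (¬ ∃ λ (m : ℕ) → ∣ d ∣ ≡ m ℕ.* m)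
-[3+4k]-negative-1mod4-nonsquare k refl =
    -<+
  , [1+n]%4≡3⇒-[1+n]%ℕ4≡1 (2 ℕ.+ k ℕ.* 4) ([m+kn]%n≡m%n 3 k 4)
  , λ (m , eq) → 3+4k≢square k m eq

Δ-sym : ∀ q₁ q₂ → Δ q₁ q₂ ≡ Δ q₂ q₁
Δ-sym q₁ q₂ = polynomial-identity (+ q₁) (+ q₂)
  where
  polynomial-identity : ∀ x y →
    (x ℤ.- y) ℤ.* (x ℤ.- y) ℤ.- + 2 ℤ.* (x ℤ.+ y) ℤ.+ + 1 ≡
    (y ℤ.- x) ℤ.* (y ℤ.- x) ℤ.- + 2 ℤ.* (y ℤ.+ x) ℤ.+ + 1
  polynomial-identity = ℤ-Solver.solve-∀

gap : ℕ → ℕ → ℤ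
gap a b = + a ℤ.- + b ℤ.- + 1

Δ≡gap²-4q₂ : ∀ q₁ q₂ → Δ q₁ q₂ ≡ gap q₁ q₂ ℤ.* gap q₁ q₂ ℤ.- + 4 ℤ.* + q₂
Δ≡gap²-4q₂ q₁ q₂ = polynomial-identity (+ q₁) (+ q₂)
  where
  polynomial-identity : ∀ x y →
    (x ℤ.- y) ℤ.* (x ℤ.- y) ℤ.- + 2 ℤ.* (x ℤ.+ y) ℤ.+ + 1 ≡
    (x ℤ.- y ℤ.- + 1) ℤ.* (x ℤ.- y ℤ.- + 1) ℤ.- + 4 ℤ.* y
  polynomial-identity = ℤ-Solver.solve-∀

m%2≡1⇒1+[m/2]*2≡m : ∀ m → m % 2 ≡ 1 → 1 ℕ.+ m / 2 ℕ.* 2 ≡ m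
m%2≡1⇒1+[m/2]*2≡m m m%2≡1 =
  sym (trans (m≡m%n+[m/n]*n m 2) (cong (ℕ._+ m / 2 ℕ.* 2) m%2≡1))

odd-gap : ∀ {q₁ q₂} → q₁ % 2 ≡ 1 → q₂ % 2 ≡ 1 → q₂ ℕ.< q₁ →
  ∃ λ b → q₂ ℕ.+ (2 ℕ.+ b ℕ.* 2) ≡ q₁
odd-gap {q₁} {q₂} q₁%2≡1 q₂%2≡1 q₂<q₁ = b , (begin
  q₂ ℕ.+ (2 ℕ.+ b ℕ.* 2)
    ≡⟨ cong (ℕ._+ (2 ℕ.+ b ℕ.* 2)) q₂≡ ⟨
  1 ℕ.+ a₂ ℕ.* 2 ℕ.+ (2 ℕ.+ b ℕ.* 2)
    ≡⟨ regroup a₂ b ⟩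
  1 ℕ.+ (ℕ.suc a₂ ℕ.+ b) ℕ.* 2
    ≡⟨ cong (λ a → 1 ℕ.+ a ℕ.* 2) a₂+1+b≡a₁ ⟩
  1 ℕ.+ a₁ ℕ.* 2
    ≡⟨ q₁≡ ⟩
  q₁ ∎)
  where
  open ≡-Reasoning
  a₁ a₂ : ℕ
  a₁ = q₁ / 2
  a₂ = q₂ / 2
  q₁≡ : 1 ℕ.+ a₁ ℕ.* 2 ≡ q₁
  q₁≡ = m%2≡1⇒1+[m/2]*2≡m q₁ q₁%2≡1
  q₂≡ : 1 ℕ.+ a₂ ℕ.* 2 ≡ q₂
  q₂≡ = m%2≡1⇒1+[m/2]*2≡m q₂ q₂%2≡1
  a₂<a₁ : a₂ ℕ.< a₁
  a₂<a₁ = ℕₚ.*-cancelʳ-< 2 a₂ a₁ (ℕₚ.≤-pred (subst₂ ℕ._<_ (sym q₂≡) (sym q₁≡) q₂<q₁))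
  b : ℕ
  b = proj₁ (ℕₚ.m≤n⇒∃[o]m+o≡n a₂<a₁)
  a₂+1+b≡a₁ : ℕ.suc a₂ ℕ.+ b ≡ a₁
  a₂+1+b≡a₁ = proj₂ (ℕₚ.m≤n⇒∃[o]m+o≡n a₂<a₁)
  regroup : ∀ a b → 1 ℕ.+ a ℕ.* 2 ℕ.+ (2 ℕ.+ b ℕ.* 2) ≡ 1 ℕ.+ (ℕ.suc a ℕ.+ b) ℕ.* 2
  regroup = ℕ-Solver.solve-∀

gap[m+1+n,m]≡+n : ∀ m n → gap (m ℕ.+ ℕ.suc n) m ≡ + n
gap[m+1+n,m]≡+n m n = begin
  + (m ℕ.+ ℕ.suc n) ℤ.- + m ℤ.- + 1
    ≡⟨ cong (λ x → x ℤ.- + m ℤ.- + 1) (ℤₚ.pos-+ m (1 ℕ.+ n)) ⟩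
  + m ℤ.+ + (1 ℕ.+ n) ℤ.- + m ℤ.- + 1
    ≡⟨ cong (λ x → + m ℤ.+ x ℤ.- + m ℤ.- + 1) (ℤₚ.pos-+ 1 n) ⟩
  + m ℤ.+ (+ 1 ℤ.+ + n) ℤ.- + m ℤ.- + 1
    ≡⟨ cancel (+ m) (+ n) ⟩
  + n ∎
  where
  open ≡-Reasoning
  cancel : ∀ x y → x ℤ.+ (+ 1 ℤ.+ y) ℤ.- x ℤ.- + 1 ≡ y
  cancel = ℤ-Solver.solve-∀

+m-+[m+n]≡-+n : ∀ m n → + m ℤ.- + (m ℕ.+ n) ≡ - + n
+m-+[m+n]≡-+n m n = trans (cong (ℤ._-_ (+ m)) (ℤₚ.pos-+ m n)) (cancel (+ m) (+ n))
  where
  cancel : ∀ x y → x ℤ.- (x ℤ.+ y) ≡ - y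
  cancel = ℤ-Solver.solve-∀

SqrtLeSqrtPlusOne⇒gap²≤4b : ∀ {a b} s → gap a b ≡ + ℕ.suc s →
  SqrtLeSqrtPlusOne a b → ℕ.suc s ℕ.* ℕ.suc s ℕ.≤ 4 ℕ.* b
SqrtLeSqrtPlusOne⇒gap²≤4b s gap≡ (inj₁ gap≤0) with subst (ℤ._≤ + 0) gap≡ gap≤0
... | +≤+ ()
SqrtLeSqrtPlusOne⇒gap²≤4b {b = b} s gap≡ (inj₂ gap²≤4b) =
  ℤₚ.drop‿+≤+ (subst₂ ℤ._≤_
    (trans (cong₂ ℤ._*_ gap≡ gap≡) (sym (ℤₚ.pos-* (ℕ.suc s) (ℕ.suc s))))
    (sym (ℤₚ.pos-* 4 b))
    gap²≤4b)

odd-square : ∀ b → (1 ℕ.+ b ℕ.* 2) ℕ.* (1 ℕ.+ b ℕ.* 2) ≡ 1 ℕ.+ (b ℕ.* b ℕ.+ b) ℕ.* 4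
odd-square = ℕ-Solver.solve-∀

odd-square≤4q⇒4q≡square+3+4k : ∀ b q → (1 ℕ.+ b ℕ.* 2) ℕ.* (1 ℕ.+ b ℕ.* 2) ℕ.≤ 4 ℕ.* q →
  ∃ λ k → 4 ℕ.* q ≡ (1 ℕ.+ b ℕ.* 2) ℕ.* (1 ℕ.+ b ℕ.* 2) ℕ.+ (3 ℕ.+ k ℕ.* 4)
odd-square≤4q⇒4q≡square+3+4k b q t²≤4q = k , (begin
  4 ℕ.* q
    ≡⟨ cong (4 ℕ.*_) c+1+k≡q ⟨
  4 ℕ.* (ℕ.suc c ℕ.+ k)
    ≡⟨ regroup c k ⟩
  1 ℕ.+ c ℕ.* 4 ℕ.+ (3 ℕ.+ k ℕ.* 4)
    ≡⟨ cong (ℕ._+ (3 ℕ.+ k ℕ.* 4)) (odd-square b) ⟨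
  (1 ℕ.+ b ℕ.* 2) ℕ.* (1 ℕ.+ b ℕ.* 2) ℕ.+ (3 ℕ.+ k ℕ.* 4) ∎)
  where
  open ≡-Reasoning
  c : ℕ
  c = b ℕ.* b ℕ.+ b
  c<q : c ℕ.< q
  c<q = ℕₚ.*-cancelʳ-< 4 c q (subst₂ ℕ._≤_ (odd-square b) (ℕₚ.*-comm 4 q) t²≤4q)
  k : ℕ
  k = proj₁ (ℕₚ.m≤n⇒∃[o]m+o≡n c<q)
  c+1+k≡q : ℕ.suc c ℕ.+ k ≡ q
  c+1+k≡q = proj₂ (ℕₚ.m≤n⇒∃[o]m+o≡n c<q)
  regroup : ∀ c k → 4 ℕ.* (ℕ.suc c ℕ.+ k) ≡ 1 ℕ.+ c ℕ.* 4 ℕ.+ (3 ℕ.+ k ℕ.* 4)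
  regroup = ℕ-Solver.solve-∀

Δ≡-[3+4k] : ∀ {q₁ q₂} → q₁ % 2 ≡ 1 → q₂ % 2 ≡ 1 → q₂ ℕ.< q₁ → SqrtLeSqrtPlusOne q₁ q₂ →
  ∃ λ k → Δ q₁ q₂ ≡ - + (3 ℕ.+ k ℕ.* 4)
Δ≡-[3+4k] {q₂ = q₂} q₁%2≡1 q₂%2≡1 q₂<q₁ √q₁≤√q₂+1 with odd-gap q₁%2≡1 q₂%2≡1 q₂<q₁
... | b , refl = k , (begin
  Δ q₁ q₂
    ≡⟨ Δ≡gap²-4q₂ q₁ q₂ ⟩
  gap q₁ q₂ ℤ.* gap q₁ q₂ ℤ.- + 4 ℤ.* + q₂
    ≡⟨ cong (λ x → x ℤ.* x ℤ.- + 4 ℤ.* + q₂) gap≡t ⟩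
  + t ℤ.* + t ℤ.- + 4 ℤ.* + q₂
    ≡⟨ cong₂ ℤ._-_ (ℤₚ.pos-* t t) (ℤₚ.pos-* 4 q₂) ⟨
  + (t ℕ.* t) ℤ.- + (4 ℕ.* q₂)
    ≡⟨ cong (λ n → + (t ℕ.* t) ℤ.- + n) 4q₂≡ ⟩
  + (t ℕ.* t) ℤ.- + (t ℕ.* t ℕ.+ (3 ℕ.+ k ℕ.* 4))
    ≡⟨ +m-+[m+n]≡-+n (t ℕ.* t) (3 ℕ.+ k ℕ.* 4) ⟩
  - + (3 ℕ.+ k ℕ.* 4) ∎)
  where
  open ≡-Reasoning
  t : ℕ
  t = 1 ℕ.+ b ℕ.* 2
  q₁ : ℕ
  q₁ = q₂ ℕ.+ ℕ.suc t
  gap≡t : gap q₁ q₂ ≡ + t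
  gap≡t = gap[m+1+n,m]≡+n q₂ t
  t²≤4q₂ : t ℕ.* t ℕ.≤ 4 ℕ.* q₂
  t²≤4q₂ = SqrtLeSqrtPlusOne⇒gap²≤4b {q₁} {q₂} (b ℕ.* 2) gap≡t √q₁≤√q₂+1
  k : ℕ
  k = proj₁ (odd-square≤4q⇒4q≡square+3+4k b q₂ t²≤4q₂)
  4q₂≡ : 4 ℕ.* q₂ ≡ t ℕ.* t ℕ.+ (3 ℕ.+ k ℕ.* 4)
  4q₂≡ = proj₂ (odd-square≤4q⇒4q≡square+3+4k b q₂ t²≤4q₂)

lemma5p1 : (q₁ q₂ : ℕ) → IsPrimePower q₁ → IsPrimePower q₂ → q₁ % 2 ≡ 1 → q₂ % 2 ≡ 1 → q₁ ≢ q₂ →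
    SqrtDistLeOne q₁ q₂ →
    (Δ q₁ q₂ < + 0) × (Δ q₁ q₂ %ℕ 4 ≡ 1) × (¬ ∃ λ (m : ℕ) → ∣ Δ q₁ q₂ ∣ ≡ m ℕ.* m)
lemma5p1 q₁ q₂ _ _ q₁%2≡1 q₂%2≡1 q₁≢q₂ (√q₁≤√q₂+1 , √q₂≤√q₁+1) with ℕₚ.<-cmp q₁ q₂
... | tri< q₁<q₂ _ _ =
  let k , Δ₂₁≡ = Δ≡-[3+4k] q₂%2≡1 q₁%2≡1 q₁<q₂ √q₂≤√q₁+1
  in -[3+4k]-negative-1mod4-nonsquare k (trans (Δ-sym q₁ q₂) Δ₂₁≡)
... | tri≈ _ q₁≡q₂ _ = ⊥-elim (q₁≢q₂ q₁≡q₂)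
... | tri> _ _ q₂<q₁ =
  let k , Δ₁₂≡ = Δ≡-[3+4k] q₁%2≡1 q₂%2≡1 q₂<q₁ √q₁≤√q₂+1
  in -[3+4k]-negative-1mod4-nonsquare k Δ₁₂≡
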